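{- If there is a derivation of a formula $A$ in $\mathsf{MLL}_{DI}$, then there is a derivation of the sequent $\vdash A$ in $\mathsf{MLL}_{SC}$.
   Context: $\wp$ denotes par and $\otimes$ tensor. Formulae are built from atoms and negated atoms using $\otimes,\wp$, with $\overline{A\otimes B}=\overline{A}\wp\overline{B}$, $\overline{A\wp B}=\overline{A}\otimes\overline{B}$, $\overline{\overline{A}}=A$; formulae are not identified up to associativity or commutativity. A context $S\{\ \}$ is a formula with one hole. $\mathsf{MLL}_{DI}$ has the axiom with conclusion $\overline{A}\wp A$ and the rules (premise $\to$ conclusion, $S$ any context): $S\{B\}\to S\{B\otimes(\overline{A}\wp A)\}$; $S\{(A\otimes\overline{A})\wp B\}\to S\{B\}$; $S\{A\wp B\}\to S\{B\wp A\}$; $S\{A\otimes B\}\to S\{B\otimes A\}$; $S\{A\wp(B\wp C)\}\to S\{(A\wp B)\wp C\}$; $S\{(A\otimes B)\otimes C\}\to S\{A\otimes(B\otimes C)\}$; $S\{A\otimes(B\wp C)\}\to S\{(A\otimes B)\wp C\}$; a derivation of $A$ is a finite sequence starting from an axiom instance, each formula obtained from the previous by a rule, ending in $A$. $\mathsf{MLL}_{SC}$ is the one-sided sequent calculus with rules: $\vdash\overline{A},A$; from $\vdash\Gamma,A,B,\Delta$ infer $\vdash\Gamma,B,A,\Delta$; from $\vdash\Gamma,A,B,\Delta$ infer $\vdash\Gamma,A\wp B,\Delta$; from $\vdash\Gamma,A$ and $\vdash B,\Delta$ infer $\vdash\Gamma,A\otimes B,\Delta$; from $\vdash\Gamma,A$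 and $\vdash\overline{A},\Delta$ infer $\vdash\Gamma,\Delta$. -}

module Defs where

open import Data.List using (List; []; _∷_; _++_; [_])
open import Data.Product using (Σ; ∃; _,_)
open import Relation.Binary.Construct.Closure.ReflexiveTransitive using (Star)

data Formula (Atom : Set) : Set where
  pos  : Atom → Formula Atom
  neg  : Atom → Formula Atom
  _⊗_  : Formula Atom → Formula Atom → Formula Atom
  _⅋_  : Formula Atom → Formula Atom → Formula Atom

infixr 6 _⊗_
infixr 5 _⅋_

module _ {Atom : Set} where

  ~_ : Formula Atom → Formula Atom
  ~ pos a   = neg a
  ~ neg a   = pos a
  ~ (A ⊗ B) = (~ A) ⅋ (~ B)
  ~ (A ⅋ B) = (~ A) ⊗ (~ B)

  data Context : Set where
    hole : Context
    _⊗ₗ_ : Context → Formula Atom → Context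
    _⊗ᵣ_ : Formula Atom → Context → Context
    _⅋ₗ_ : Context → Formula Atom → Context
    _⅋ᵣ_ : Formula Atom → Context → Context

  _⟦_⟧ : Context → Formula Atom → Formula Atom
  hole     ⟦ A ⟧ = A
  (S ⊗ₗ B) ⟦ A ⟧ = (S ⟦ A ⟧) ⊗ B
  (B ⊗ᵣ S) ⟦ A ⟧ = B ⊗ (S ⟦ A ⟧)
  (S ⅋ₗ B) ⟦ A ⟧ = (S ⟦ A ⟧) ⅋ B
  (B ⅋ᵣ S) ⟦ A ⟧ = B ⅋ (S ⟦ A ⟧)

  -- the root-level rewrite rules of MLL_DI (premise ⟶ conclusion)
  data Rule : Formula Atom → Formula Atom → Set where
    ai↓    : ∀ A B   → Rule B (B ⊗ ((~ A) ⅋ A))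
    ai↑    : ∀ A B   → Rule ((A ⊗ (~ A)) ⅋ B) B
    ⅋-comm : ∀ A B   → Rule (A ⅋ B) (B ⅋ A)
    ⊗-comm : ∀ A B   → Rule (A ⊗ B) (B ⊗ A)
    ⅋-asc  : ∀ A B C → Rule (A ⅋ (B ⅋ C)) ((A ⅋ B) ⅋ C)
    ⊗-asc  : ∀ A B C → Rule ((A ⊗ B) ⊗ C) (A ⊗ (B ⊗ C))
    switch : ∀ A B C → Rule (A ⊗ (B ⅋ C)) ((A ⊗ B) ⅋ C)

  data Step : Formula Atom → Formula Atom → Set where
    step : ∀ S {P Q} → Rule P Q → Step (S ⟦ P ⟧) (S ⟦ Q ⟧)

  DIDerivation : Formula Atom → Set
  DIDerivation A = Σ (Formula Atom) λ B → Star Step ((~ B) ⅋ B) A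

  data ⊢_ : List (Formula Atom) → Set where
    ax   : ∀ A → ⊢ ((~ A) ∷ A ∷ [])
    exch : ∀ Γ A B Δ → ⊢ (Γ ++ A ∷ B ∷ Δ) → ⊢ (Γ ++ B ∷ A ∷ Δ)
    par  : ∀ Γ A B Δ → ⊢ (Γ ++ A ∷ B ∷ Δ) → ⊢ (Γ ++ (A ⅋ B) ∷ Δ)
    tens : ∀ Γ A B Δ → ⊢ (Γ ++ [ A ]) → ⊢ (B ∷ Δ) → ⊢ (Γ ++ (A ⊗ B) ∷ Δ)
    cut  : ∀ Γ A Δ → ⊢ (Γ ++ [ A ]) → ⊢ ((~ A) ∷ Δ) → ⊢ (Γ ++ Δ)

module Submission where

open import Defs
open import Data.List using ([]; _∷_)
open import Data.Product using (_,_)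
open import Relation.Binary.Construct.Closure.ReflexiveTransitive using (Star; ε; _◅_)

-- Every rule instance P ⟶ Q of MLL_DI is a provable linear implication
-- ⊢ ~P, Q; provable implications are preserved by plugging into a context
-- because ⊗ and ⅋ are monotone; and cut turns ⊢ P together with ⊢ ~P, Q into
-- ⊢ Q, so cutting along the derivation carries ⊢ ~B ⅋ B to ⊢ A.

module _ {Atom : Set} where

  infix 4 _⊸_

  _⊸_ : Formula Atom → Formula Atom → Set
  P ⊸ Q = ⊢ ((~ P) ∷ Q ∷ [])

  exch₀ : ∀ {A B : Formula Atom} {Δ} → ⊢ (A ∷ B ∷ Δ) → ⊢ (B ∷ A ∷ Δ)
  exch₀ {A} {B} {Δ} = exch [] A B Δ

  ⊸-refl : (A : Formula Atom) → A ⊸ A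
  ⊸-refl = ax

  -- ~ ~ A is not definitionally A, so this form of the axiom is derived.
  ax-flipped : (A : Formula Atom) → ⊢ (A ∷ (~ A) ∷ [])
  ax-flipped A = exch₀ (ax A)

  ⊗-monoˡ : ∀ {P Q} B → P ⊸ Q → P ⊗ B ⊸ Q ⊗ B
  ⊗-monoˡ {P} {Q} B d =
    par [] (~ P) (~ B) _ (exch ((~ P) ∷ []) _ (~ B) []
      (tens ((~ P) ∷ []) Q B ((~ B) ∷ []) d (ax-flipped B)))

  ⊗-monoʳ : ∀ {P Q} B → P ⊸ Q → B ⊗ P ⊸ B ⊗ Q
  ⊗-monoʳ {P} {Q} B d =
    par [] (~ B) (~ P) _ (exch ((~ B) ∷ []) _ (~ P) []
      (tens ((~ B) ∷ []) B Q ((~ P) ∷ []) (ax B) (exch₀ d)))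

  ⅋-monoˡ : ∀ {P Q} B → P ⊸ Q → P ⅋ B ⊸ Q ⅋ B
  ⅋-monoˡ {P} {Q} B d =
    exch₀ (par [] Q B _ (exch (Q ∷ []) _ B []
      (tens (Q ∷ []) (~ P) (~ B) (B ∷ []) (exch₀ d) (ax B))))

  ⅋-monoʳ : ∀ {P Q} B → P ⊸ Q → B ⅋ P ⊸ B ⅋ Q
  ⅋-monoʳ {P} {Q} B d =
    par (_ ∷ []) B Q [] (exch₀
      (tens (B ∷ []) (~ B) (~ P) (Q ∷ []) (ax-flipped B) d))

  ⟦⟧-mono : ∀ (S : Context) {P Q} → P ⊸ Q → S ⟦ P ⟧ ⊸ S ⟦ Q ⟧
  ⟦⟧-mono hole     d = d
  ⟦⟧-mono (S ⊗ₗ B) d = ⊗-monoˡ B (⟦⟧-mono S d)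
  ⟦⟧-mono (B ⊗ᵣ S) d = ⊗-monoʳ B (⟦⟧-mono S d)
  ⟦⟧-mono (S ⅋ₗ B) d = ⅋-monoˡ B (⟦⟧-mono S d)
  ⟦⟧-mono (B ⅋ᵣ S) d = ⅋-monoʳ B (⟦⟧-mono S d)

  Rule⇒⊸ : ∀ {P Q} → Rule P Q → P ⊸ Q
  Rule⇒⊸ (ai↓ A B) = tens ((~ B) ∷ []) B _ [] (ax B) (par [] (~ A) A [] (ax A))
  Rule⇒⊸ (ai↑ A B) =
    tens [] _ (~ B) (B ∷ []) (par [] (~ A) (~ (~ A)) [] (ax-flipped (~ A))) (ax B)
  Rule⇒⊸ (⅋-comm A B) =
    exch₀ (par [] B A _ (exch₀ (exch (A ∷ []) _ B []
      (tens (A ∷ []) (~ A) (~ B) (B ∷ []) (ax-flipped A) (ax B)))))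
  Rule⇒⊸ (⊗-comm A B) =
    par [] (~ A) (~ B) _ (exch₀ (exch ((~ B) ∷ []) _ (~ A) []
      (tens ((~ B) ∷ []) B A ((~ A) ∷ []) (ax B) (ax-flipped A))))
  Rule⇒⊸ (⅋-asc A B C) =
    exch₀ (par [] (A ⅋ B) C _ (par [] A B (C ∷ _ ∷ [])
      (exch (A ∷ B ∷ []) _ C [] (exch (A ∷ []) _ B (C ∷ [])
        (tens (A ∷ []) (~ A) _ (B ∷ C ∷ []) (ax-flipped A)
          (exch₀ (tens (B ∷ []) (~ B) (~ C) (C ∷ []) (ax-flipped B) (ax C))))))))
  Rule⇒⊸ (⊗-asc A B C) =
    par [] _ (~ C) _ (par [] (~ A) (~ B) ((~ C) ∷ _ ∷ [])
      (exch ((~ A) ∷ (~ B) ∷ []) _ (~ C) [] (exch ((~ A) ∷ []) _ (~ B) ((~ C) ∷ [])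
        (tens ((~ A) ∷ []) A _ ((~ B) ∷ (~ C) ∷ []) (ax A)
          (exch₀ (tens ((~ B) ∷ []) B C ((~ C) ∷ []) (ax B) (ax-flipped C)))))))
  Rule⇒⊸ (switch A B C) =
    par [] (~ A) _ _ (par ((~ A) ∷ _ ∷ []) (A ⊗ B) C []
      (exch ((~ A) ∷ []) _ _ (C ∷ [])
        (tens ((~ A) ∷ (A ⊗ B) ∷ []) (~ B) (~ C) (C ∷ [])
          (tens ((~ A) ∷ []) A B ((~ B) ∷ []) (ax A) (ax-flipped B)) (ax C))))

  Step⇒⊸ : ∀ {X Y} → Step X Y → X ⊸ Y
  Step⇒⊸ (step S r) = ⟦⟧-mono S (Rule⇒⊸ r)

  ⊸-elim : ∀ {P Q} → ⊢ (P ∷ []) → P ⊸ Q → ⊢ (Q ∷ [])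
  ⊸-elim {P} {Q} = cut [] P (Q ∷ [])

  ⊢-Star : ∀ {X Y} → ⊢ (X ∷ []) → Star Step X Y → ⊢ (Y ∷ [])
  ⊢-Star d ε        = d
  ⊢-Star d (s ◅ ss) = ⊢-Star (⊸-elim d (Step⇒⊸ s)) ss

proposition4p3 : {Atom : Set} (A : Formula Atom) → DIDerivation A → ⊢ (A ∷ [])
proposition4p3 A (B , derivation) = ⊢-Star (par [] (~ B) B [] (⊸-refl B)) derivation
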